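{- Let $P\subseteq\mathbb{R}^m$ be a full-dimensional convex lattice polytope, $n,k\ge1$, $\mathbf{a}'\in\mathbb{Z}^m$, and consider the bigraded $Z_k\wr S_n$-module $\mathbb{C}[P^{\times n}]$ (bigraded by projective degree and the combinatorial degree for $\mathbf{a}=(\mathbf{a}')^{\times n}$). Then for $\sigma\in Z_k\wr S_n$ of cycle type $\vec\lambda(\sigma)=\vec\lambda=(\lambda^0,\dots,\lambda^{k-1})$, \[ \chi^{\mathbb{C}[P^{\times n}]}(\sigma)=\sum_{d\ge0}t^d\prod_{i=0}^{k-1}\prod_{j=1}^{\ell(\lambda^i)}\ \sum_{v\in dP\cap\mathbb{Z}^m}u_i^{|v|}\,q^{\lambda^i_j\,(\mathbf{a}'\cdot v)}, \] where $|v|$ is the sum of the coordinates of $v$.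
   Context: $u_j=e^{2\pi ij/k}$. $\mathbb{C}[P^{\times n}]\subseteq\mathbb{C}[t,x_{1,1}^{\pm1},\dots,x_{n,m}^{\pm1}]$ is spanned by the monomials $x_{d,v}=t^d\prod_{i=1}^n\prod_{j=1}^m x_{i,j}^{\pi_j(v_i)}$, $d\in\mathbb{N}$, $v_i\in dP\cap\mathbb{Z}^m$ ($\pi_j$ the $j$-th coordinate), with projective degree $d$ and combinatorial degree $\sum_{i}\mathbf{a}'\cdot v_i$. An element $\sigma\in Z_k\wr S_n$ (matrix with one nonzero entry per row and column, entries $k$-th roots of unity) has permutation $\sigma_1\cdots\sigma_n$ and roots $u(\sigma,i)$ (entry of row $i$, in column $\sigma_i$); it acts by fixing $t$ and $x_{i,j}\mapsto u(\sigma,i)x_{\sigma_i,j}$, extended multiplicatively and linearly. The cycles of $\sigma$ are those of $i\mapsto\sigma_i$; a cycle $(i_1,\dots,i_r)$ is a $C_j$-cycle if $\prod_l u(\sigma,i_l)=u_j$; the cycle type $\vec\lambda(\sigma)$ has $\lambda^j$ the partition formed by the lengths of the $C_j$-cycles. The bigraded character is $\chi^{\mathbb{C}[P^{\times n}]}(\sigma)=\sum_{d,e}\operatorname{tr}(\sigma|_{\mathbb{C}[P^{\times n}]_{d,e}})\,t^dq^e$, the piece of projective degree $d$ and combinatorial degree $e$. -}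

module Defs where

open import Level using (Level)
open import Data.Bool using (Bool; true; false; if_then_else_; _∧_)
open import Data.Nat as ℕ using (ℕ; zero; suc; NonZero)
open import Data.Integer as ℤ using (ℤ; +_)
open import Data.Integer.DivMod using (_%ℕ_)
open import Data.Nat.DivMod using () renaming (_mod_ to _modᶠ_)
open import Data.Rational as ℚ using (ℚ; 0ℚ; 1ℚ)
open import Data.Fin as Fin using (Fin; toℕ)
open import Data.Fin.Permutation using (Permutation′; _⟨$⟩ʳ_; _⟨$⟩ˡ_)
open import Data.Vec as Vec using (Vec; []; _∷_; lookup; tabulate)
open import Data.Vec.Properties using (≡-dec)
open import Data.List as List using (List; []; _∷_; map; concatMap; foldr; allFin; upTo; filterᵇ; takeWhileᵇ; length)
open import Data.Product using (Σ; ∃; _×_; _,_)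
open import Relation.Nullary using (does)
open import Relation.Binary.PropositionalEquality using (_≡_)
open import Algebra.Bundles using (CommutativeRing)

sumℤ : ∀ {m} → Vec ℤ m → ℤ
sumℤ = Vec.foldr _ ℤ._+_ (+ 0)

∣_∣ᵥ : ∀ {m} → Vec ℤ m → ℤ
∣ v ∣ᵥ = sumℤ v

_·_ : ∀ {m} → Vec ℤ m → Vec ℤ m → ℤ
a · v = sumℤ (Vec.zipWith ℤ._*_ a v)

-- Lattice polytopes, given as convex hulls of finitely many lattice points
-- V : Fin r → ℤ^m (the vertex/generator list).

ℤ→ℚ : ℤ → ℚ
ℤ→ℚ z = z ℚ./ 1

sumℚ : ∀ {r} → (Fin r → ℚ) → ℚ
sumℚ f = foldr ℚ._+_ 0ℚ (List.tabulate f)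

-- v ∈ dP ∩ ℤ^m, where P = conv(V): v is a (rational) convex combination
-- of the points of V, scaled by d.
InDilate : ∀ {r m} → (Fin r → Vec ℤ m) → ℕ → Vec ℤ m → Set
InDilate {r} {m} V d v =
  Σ (Fin r → ℚ) λ w →
    (∀ l → 0ℚ ℚ.≤ w l) ×
    (sumℚ w ≡ ℤ→ℚ (+ d)) ×
    (∀ (j : Fin m) → sumℚ (λ l → w l ℚ.* ℤ→ℚ (lookup (V l) j)) ≡ ℤ→ℚ (lookup v j))

-- conv(V) is full-dimensional: the affine hull of V is all of ℚ^m
-- (equivalently ℝ^m, since V is rational).
FullDimensional : ∀ {r m} → (Fin r → Vec ℤ m) → Set
FullDimensional {r} {m} V =
  ∀ (x : Vec ℚ m) → Σ (Fin r → ℚ) λ μ →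
    (sumℚ μ ≡ 1ℚ) ×
    (∀ (j : Fin m) → sumℚ (λ l → μ l ℚ.* ℤ→ℚ (lookup (V l) j)) ≡ lookup x j)

-- Elements of Z_k ≀ S_n: a permutation i ↦ σ_i together with, for each
-- row i, the exponent c i ∈ Z_k of the root u(σ,i) = u_{c i} = ζ^{c i}.

record Wreath (k n : ℕ) : Set where
  constructor wreath
  field
    perm  : Permutation′ n
    roots : Fin n → Fin k
open Wreath public

iter : ∀ {k n} → Wreath k n → ℕ → Fin n → Fin n
iter σ zero    i = i
iter σ (suc s) i = perm σ ⟨$⟩ʳ iter σ s i

eqFin : ∀ {n} → Fin n → Fin n → Bool
eqFin i j = does (i Fin.≟ j)

cycLen : ∀ {k n} → Wreath k n → Fin n → ℕ
cycLen {n = n} σ i =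
  suc (length (takeWhileᵇ (λ j → Data.Bool.not (eqFin j i))
                          (map (λ s → iter σ (suc s) i) (upTo n))))

orbit : ∀ {k n} → Wreath k n → Fin n → List (Fin n)
orbit σ i = map (λ s → iter σ s i) (upTo (cycLen σ i))

isRep : ∀ {k n} → Wreath k n → Fin n → Bool
isRep σ i = foldr (λ j b → does (toℕ i ℕ.≤? toℕ j) ∧ b) true (orbit σ i)

-- class of the cycle through i: the cycle is a C_j-cycle iff
-- ∏ u(σ,i_l) = u_j, i.e. Σ c(i_l) ≡ j (mod k)
cycClass : ∀ {k n} .{{_ : NonZero k}} → Wreath k n → Fin n → Fin k
cycClass {k} σ i = foldr ℕ._+_ 0 (map (λ j → toℕ (roots σ j)) (orbit σ i)) modᶠ k

-- cycle type: λ^j = list of lengths of the C_j-cycles (as a multiset,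
-- listed in order of their least elements)
cycleType : ∀ {k n} .{{_ : NonZero k}} → Wreath k n → Fin k → List ℕ
cycleType σ j =
  map (cycLen σ) (filterᵇ (λ i → isRep σ i ∧ eqFin (cycClass σ i) j) (allFin _))

tuples : ∀ {a} {A : Set a} → List A → (n : ℕ) → List (Vec A n)
tuples L zero    = [] ∷ []
tuples L (suc n) = concatMap (λ x → map (x ∷_) (tuples L n)) L

combDeg : ∀ {m n} → Vec ℤ m → Vec (Vec ℤ m) n → ℤ
combDeg a v = Vec.foldr _ ℤ._+_ (+ 0) (Vec.map (a ·_) v)

-- σ maps x_{d,v} to (∏_i u(σ,i)^{|v_i|}) x_{d,w}, where w_{σ_i} = v_i
actMon : ∀ {k m n} → Wreath k n → Vec (Vec ℤ m) n → Vec (Vec ℤ m) n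
actMon σ v = tabulate (λ j → lookup v (perm σ ⟨$⟩ˡ j))

eqMon : ∀ {m n} → Vec (Vec ℤ m) n → Vec (Vec ℤ m) n → Bool
eqMon v w = does (≡-dec (≡-dec ℤ._≟_) v w)

-- Coefficients: a commutative ring R containing ζ (playing u_1 = e^{2πi/k});
-- u_j = ζ^j.  Laurent polynomials in q as formal finite sums of terms.

module Coeffs {c ℓ : Level} (R : CommutativeRing c ℓ) (k : ℕ) .{{_ : NonZero k}}
              (ζ : CommutativeRing.Carrier R) where
  open CommutativeRing R

  pow : Carrier → ℕ → Carrier
  pow x zero    = 1#
  pow x (suc e) = x * pow x e

  upow : Fin k → ℤ → Carrier
  upow j z = pow ζ ((+ toℕ j ℤ.* z) %ℕ k)

  Σᴿ : List Carrier → Carrier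
  Σᴿ = foldr _+_ 0#

  Πᴿ : List Carrier → Carrier
  Πᴿ = foldr _*_ 1#

  LPoly : Set c
  LPoly = List (ℤ × Carrier)

  coeff : ℤ → LPoly → Carrier
  coeff e p = Σᴿ (map (λ { (e′ , r) → if does (e′ ℤ.≟ e) then r else 0# }) p)

  _⊗_ : LPoly → LPoly → LPoly
  p ⊗ p′ = concatMap (λ { (a , r) → map (λ { (b , s) → (a ℤ.+ b , r * s) }) p′ }) p

  prodP : List LPoly → LPoly
  prodP = foldr _⊗_ ((+ 0 , 1#) ∷ [])

  -- trace of σ on C[P^{×n}]_{d,e}, computed in the monomial basis
  -- {x_{d,v} : v ∈ Ld^n, combDeg v = e}, where Ld lists dP ∩ ℤ^m.
  -- Diagonal entry at x_{d,v}: ∏_i u(σ,i)^{|v_i|} if σ x_{d,v} ∈ R x_{d,v}, else 0.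
  trace : ∀ {m n} → Wreath k n → Vec ℤ m → List (Vec ℤ m) → ℤ → Carrier
  trace {n = n} σ a Ld e =
    Σᴿ (map (λ v → if eqMon (actMon σ v) v
                     then Πᴿ (List.tabulate (λ i → upow (roots σ i) ∣ lookup v i ∣ᵥ))
                     else 0#)
            (filterᵇ (λ v → does (combDeg a v ℤ.≟ e)) (tuples Ld n)))

  -- coefficient of t^d in the right-hand side:
  -- ∏_{i=0}^{k-1} ∏_{j=1}^{ℓ(λ^i)} Σ_{v ∈ dP∩ℤ^m} u_i^{|v|} q^{λ^i_j (a'·v)}
  rhsPoly : ∀ {m} → Vec ℤ m → List (Vec ℤ m) → (Fin k → List ℕ) → LPoly
  rhsPoly a Ld λ′ =
    prodP (map (λ i → prodP (map (λ len → map (λ v → (+ len ℤ.* (a · v) , upow i ∣ v ∣ᵥ)) Ld)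
                                 (λ′ i)))
               (allFin k))

module Submission where

open import Defs
open import Level using (Level)
open import Function using (_∘_; Equivalence; Injection)
open import Function.Bundles using (_⇔_)
open import Function.Properties.Inverse using (Inverse⇒Injection)
open import Data.Bool using (Bool; true; false; not; T; _∧_; if_then_else_)
open import Data.Bool.Properties using (T-∧)
open import Data.Nat as ℕ using (ℕ; zero; suc; _<_; _≤_; z≤n; s≤s; NonZero)
import Data.Nat.Properties as ℕ
import Data.Nat.DivMod as ℕ
open import Data.Integer as ℤ using (ℤ; +_; -[1+_]; _-_; _%ℕ_; _/ℕ_)
import Data.Integer.Properties as ℤ
open import Data.Integer.DivMod using (a≡a%ℕn+[a/ℕn]*n)
open import Data.Integer.Tactic.RingSolver using (solve-∀)
open import Data.Fin as Fin using (Fin; toℕ)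
import Data.Fin.Properties as Fin
open import Data.Fin.Permutation using (_⟨$⟩ʳ_; _⟨$⟩ˡ_; inverseˡ; inverseʳ)
open import Data.Vec as Vec using (Vec; []; _∷_)
import Data.Vec.Properties as Vec
open import Data.List as List
  using (List; []; _∷_; _++_; map; foldr; concat; concatMap; applyUpTo; takeWhileᵇ; filterᵇ; allFin; length)
import Data.List.Properties as List
open import Data.List.Membership.Propositional using (_∈_; find)
open import Data.List.Membership.Propositional.Properties
  using (∈-applyUpTo⁺; ∈-applyUpTo⁻; ∈-concatMap⁺; ∈-concatMap⁻; ∈-map⁺; ∈-map⁻; ∈-filter⁺; ∈-filter⁻; ∈-allFin; ∈-lookup)
open import Data.List.Relation.Unary.Any as Any using (here; there)
import Data.List.Relation.Unary.Any.Properties as Any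
import Data.List.Relation.Unary.All as All
import Data.List.Relation.Unary.All.Properties as All
open import Data.List.Relation.Unary.AllPairs using ([]; _∷_)
open import Data.List.Relation.Unary.Unique.Propositional using (Unique)
import Data.List.Relation.Unary.Unique.Propositional.Properties as Unique
import Data.List.Extrema ℕ.≤-totalOrder as Extrema
open import Data.Product using (∃; _×_; _,_; proj₁; proj₂)
open import Data.Sum using (inj₁; inj₂; [_,_]′)
open import Relation.Nullary using (Dec; yes; no; ¬_; does; contradiction)
open import Relation.Nullary.Decidable using (T?; dec-true)
open import Relation.Binary.Definitions using (DecidableEquality)
open import Relation.Binary.PropositionalEquality as ≡ using (_≡_; _≢_)
import Relation.Binary.Reasoning.Setoid
open import Algebra.Bundles using (CommutativeRing)

-- The trace is taken in the monomial basis, so only the monomials x_{d,v} that σ maps to a multiple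
-- of themselves contribute, each with the diagonal entry ∏ᵢ u(σ,i)^{|vᵢ|}. These are exactly the
-- tuples v that are constant on the cycles of σ, i.e. a choice of one lattice point g_C for every
-- cycle C. For such a tuple the combinatorial degree is Σ_C |C| (a′·g_C), and since the roots along
-- a C_j-cycle multiply to u_j, the diagonal entry is ∏_C u_j^{|g_C|}. Expanding the right-hand side,
-- a product with one factor Σ_v u_j^{|v|} q^{|C| (a′·v)} per cycle, gives the same sum over (g_C)_C.

module _ {p} {P : Set p} where

  from-T-does : (P? : Dec P) → T (does P?) → P
  from-T-does (yes p) _ = p

  to-T-does : (P? : Dec P) → P → T (does P?)
  to-T-does (yes _) _ = _
  to-T-does (no ¬p) p = ¬p p

module _ {a} {A : Set a} where
  open ≡ using (refl; sym; cong)

  lookup-injective : ∀ {xs : List A} → Unique xs → ∀ {i j} → List.lookup xs i ≡ List.lookup xs j → i ≡ j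
  lookup-injective {_ ∷ _} _           {Fin.zero}  {Fin.zero}  _  = refl
  lookup-injective {_ ∷ _} (x∉xs ∷ _) {Fin.zero}  {Fin.suc j} eq = contradiction eq (All.lookup x∉xs (∈-lookup j))
  lookup-injective {_ ∷ _} (x∉xs ∷ _) {Fin.suc i} {Fin.zero}  eq = contradiction (sym eq) (All.lookup x∉xs (∈-lookup i))
  lookup-injective {_ ∷ _} (_ ∷ u)    {Fin.suc i} {Fin.suc j} eq = cong Fin.suc (lookup-injective u eq)

  module _ {b} {B : Set b} where
    concatMap-unique : ∀ {f : A → List B} {xs} → Unique xs → (∀ x → Unique (f x)) →
                       (∀ {x x′ y} → y ∈ f x → y ∈ f x′ → x ≡ x′) → Unique (concatMap f xs)
    concatMap-unique {xs = []}     _          _        _        = []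
    concatMap-unique {f} {x ∷ xs} (x∉xs ∷ u) f-unique disjoint =
      Unique.++⁺ (f-unique x) (concatMap-unique u f-unique disjoint) λ (y∈fx , y∈rest) →
        let x′ , x′∈xs , y∈fx′ = find (∈-concatMap⁻ f y∈rest) in All.lookup x∉xs x′∈xs (disjoint y∈fx y∈fx′)

  module _ (p : A → Bool) where

    length-takeWhileᵇ-≤ : ∀ h n → length (takeWhileᵇ p (applyUpTo h n)) ≤ n
    length-takeWhileᵇ-≤ h zero    = z≤n
    length-takeWhileᵇ-≤ h (suc n) with p (h 0)
    ... | true  = s≤s (length-takeWhileᵇ-≤ (h ∘ suc) n)
    ... | false = z≤n

    takeWhileᵇ-holds : ∀ h n {s} → s < length (takeWhileᵇ p (applyUpTo h n)) → T (p (h s))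
    takeWhileᵇ-holds h (suc n) {s} lt with p (h 0) in eq
    takeWhileᵇ-holds h (suc n) {zero}  _          | true = ≡.subst T (sym eq) _
    takeWhileᵇ-holds h (suc n) {suc s} (s≤s lt)   | true = takeWhileᵇ-holds (h ∘ suc) n lt

    takeWhileᵇ-stops : ∀ h n → length (takeWhileᵇ p (applyUpTo h n)) < n →
                       ¬ T (p (h (length (takeWhileᵇ p (applyUpTo h n)))))
    takeWhileᵇ-stops h (suc n) lt with p (h 0) in eq
    ... | false = ≡.subst (¬_ ∘ T) (sym eq) (λ ())
    ... | true  = takeWhileᵇ-stops (h ∘ suc) n (ℕ.≤-pred lt)

  ∈-tuples⁺ : ∀ {L : List A} {n} (v : Vec A n) → (∀ i → Vec.lookup v i ∈ L) → v ∈ tuples L n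
  ∈-tuples⁺         []      _  = here refl
  ∈-tuples⁺ {L} {suc n} (x ∷ v) ∈L = ∈-concatMap⁺ (λ y → map (y ∷_) (tuples L n))
    (Any.map (λ { refl → ∈-map⁺ (x ∷_) (∈-tuples⁺ v (∈L ∘ Fin.suc)) }) (∈L Fin.zero))

  ∈-tuples⁻ : ∀ {L : List A} {n} {v : Vec A n} → v ∈ tuples L n → ∀ i → Vec.lookup v i ∈ L
  ∈-tuples⁻ {L} {suc n} v∈ i with find (∈-concatMap⁻ (λ y → map (y ∷_) (tuples L n)) {xs = L} v∈)
  ... | y , y∈L , v∈y with ∈-map⁻ (y ∷_) v∈y
  ...   | w , w∈ , refl with i
  ...     | Fin.zero   = y∈L
  ...     | Fin.suc i′ = ∈-tuples⁻ w∈ i′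

  tuples-unique : ∀ {L : List A} → Unique L → ∀ n → Unique (tuples L n)
  tuples-unique L! zero    = All.[] ∷ []
  tuples-unique L! (suc n) = concatMap-unique L! (λ x → Unique.map⁺ (λ { refl → refl }) (tuples-unique L! n)) same-head
    where
    same-head : ∀ {x x′ v} → v ∈ map (x ∷_) _ → v ∈ map (x′ ∷_) _ → x ≡ x′
    same-head v∈ v∈′ with ∈-map⁻ _ v∈ | ∈-map⁻ _ v∈′
    ... | _ , _ , refl | _ , _ , refl = refl

module FiniteSum {c ℓ : Level} (R : CommutativeRing c ℓ) where
  open CommutativeRing R
  open import Algebra.Properties.CommutativeSemigroup +-commutativeSemigroup using (interchange)
  open import Relation.Binary.Reasoning.Setoid setoid

  module _ {a} {A : Set a} where

    ∑ : (A → Carrier) → List A → Carrier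
    ∑ f xs = foldr _+_ 0# (map f xs)

    ∑-cong : ∀ {f g : A → Carrier} xs → (∀ {x} → x ∈ xs → f x ≈ g x) → ∑ f xs ≈ ∑ g xs
    ∑-cong []       f≈g = refl
    ∑-cong (x ∷ xs) f≈g = +-cong (f≈g (here ≡.refl)) (∑-cong xs (f≈g ∘ there))

    ∑-++ : ∀ f xs ys → ∑ f (xs ++ ys) ≈ ∑ f xs + ∑ f ys
    ∑-++ f []       ys = sym (+-identityˡ _)
    ∑-++ f (x ∷ xs) ys = trans (+-congˡ (∑-++ f xs ys)) (sym (+-assoc _ _ _))

    ∑-zero : ∀ xs → ∑ (λ _ → 0#) xs ≈ 0#
    ∑-zero []       = refl
    ∑-zero (x ∷ xs) = trans (+-identityˡ _) (∑-zero xs)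

    ∑-+ : ∀ f g xs → ∑ (λ x → f x + g x) xs ≈ ∑ f xs + ∑ g xs
    ∑-+ f g []       = sym (+-identityˡ _)
    ∑-+ f g (x ∷ xs) = trans (+-congˡ (∑-+ f g xs)) (interchange (f x) (g x) _ _)

    *-distribˡ-∑ : ∀ z f xs → z * ∑ f xs ≈ ∑ (λ x → z * f x) xs
    *-distribˡ-∑ z f []       = zeroʳ z
    *-distribˡ-∑ z f (x ∷ xs) = trans (distribˡ z _ _) (+-congˡ (*-distribˡ-∑ z f xs))

    *-distribʳ-∑ : ∀ z f xs → ∑ f xs * z ≈ ∑ (λ x → f x * z) xs
    *-distribʳ-∑ z f []       = zeroˡ z
    *-distribʳ-∑ z f (x ∷ xs) = trans (distribʳ z _ _) (+-congˡ (*-distribʳ-∑ z f xs))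

    ∑-filterᵇ : ∀ f (p : A → Bool) xs → ∑ f (filterᵇ p xs) ≈ ∑ (λ x → if p x then f x else 0#) xs
    ∑-filterᵇ f p []       = refl
    ∑-filterᵇ f p (x ∷ xs) with p x
    ... | true  = +-congˡ (∑-filterᵇ f p xs)
    ... | false = trans (∑-filterᵇ f p xs) (sym (+-identityˡ _))

    ∑-if-none : ∀ (b : A → Bool) (f : A → Carrier) xs → (∀ {y} → y ∈ xs → ¬ T (b y)) →
                ∑ (λ y → if b y then f y else 0#) xs ≈ 0#
    ∑-if-none b f xs none = trans (∑-cong xs vanish) (∑-zero xs)
      where
      vanish : ∀ {y} → y ∈ xs → (if b y then f y else 0#) ≈ 0#
      vanish {y} y∈xs with b y | none y∈xs
      ... | false | _    = refl
      ... | true  | ¬T⊤ = contradiction _ ¬T⊤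

    ∑-if-unique : ∀ (b : A → Bool) (f : A → Carrier) {x} xs → Unique xs → x ∈ xs →
                  (∀ {y} → T (b y) → y ≡ x) → T (b x) →
                  ∑ (λ y → if b y then f y else 0#) xs ≈ f x
    ∑-if-unique b f (x ∷ xs) (x∉xs ∷ _) (here ≡.refl) only bx with b x
    ... | true = trans (+-congˡ (∑-if-none b f xs (λ y∈xs by → All.lookup x∉xs y∈xs (≡.sym (only by))))) (+-identityʳ _)
    ∑-if-unique b f (y ∷ xs) (y∉xs ∷ u) (there x∈xs) only bx with b y in by
    ... | true  = contradiction (only (≡.subst T (≡.sym by) _)) (All.lookup y∉xs x∈xs)
    ... | false = trans (+-identityˡ _) (∑-if-unique b f xs u x∈xs only bx)

  module _ {a b} {A : Set a} {B : Set b} where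

    ∑-map : ∀ (f : B → Carrier) (h : A → B) xs → ∑ f (map h xs) ≡ ∑ (f ∘ h) xs
    ∑-map f h xs = ≡.cong (foldr _+_ 0#) (≡.sym (List.map-∘ xs))

    ∑-concatMap : ∀ (f : B → Carrier) (h : A → List B) xs → ∑ f (concatMap h xs) ≈ ∑ (∑ f ∘ h) xs
    ∑-concatMap f h []       = refl
    ∑-concatMap f h (x ∷ xs) = trans (∑-++ f (h x) (concatMap h xs)) (+-congˡ (∑-concatMap f h xs))

    ∑-comm : ∀ (f : A → B → Carrier) xs ys → ∑ (λ x → ∑ (f x) ys) xs ≈ ∑ (λ y → ∑ (λ x → f x y) xs) ys
    ∑-comm f []       ys = sym (∑-zero ys)
    ∑-comm f (x ∷ xs) ys = trans (+-congˡ (∑-comm f xs ys)) (sym (∑-+ (f x) _ ys))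

  module _ {a} {A : Set a} (_≟_ : DecidableEquality A) where

    -- Both sides equal Σ_{x ∈ xs} Σ_{y ∈ ys} [y = x] f y.
    ∑-same-elements : ∀ (f : A → Carrier) {xs ys} → Unique xs → Unique ys →
                      (∀ {x} → x ∈ xs → x ∈ ys) → (∀ {y} → y ∈ ys → y ∈ xs) → ∑ f xs ≈ ∑ f ys
    ∑-same-elements f {xs} {ys} xs! ys! xs⊆ys ys⊆xs = begin
      ∑ f xs
        ≈⟨ ∑-cong xs (λ {x} x∈xs → sym (∑-if-unique (λ y → does (y ≟ x)) f ys ys! (xs⊆ys x∈xs)
                                                    (λ {y} → from-T-does (y ≟ x)) (to-T-does (x ≟ x) ≡.refl))) ⟩
      ∑ (λ x → ∑ (δf x) ys) xs
        ≈⟨ ∑-comm δf xs ys ⟩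
      ∑ (λ y → ∑ (λ x → δf x y) xs) ys
        ≈⟨ ∑-cong ys (λ {y} y∈ys → ∑-if-unique (λ x → does (y ≟ x)) (λ _ → f y) xs xs! (ys⊆xs y∈ys)
                                               (λ {x} → ≡.sym ∘ from-T-does (y ≟ x)) (to-T-does (y ≟ y) ≡.refl)) ⟩
      ∑ f ys
        ∎
      where
      δf : A → A → Carrier
      δf x y = if does (y ≟ x) then f y else 0#

  ∑-tabulate : ∀ {a} {A : Set a} {N} (f : A → Carrier) (g : Fin N → A) →
               ∑ f (List.tabulate g) ≡ ∑ (f ∘ g) (allFin N)
  ∑-tabulate f g = ≡.cong (foldr _+_ 0#) (≡.trans (List.map-tabulate g f) (≡.sym (List.map-tabulate (λ i → i) (f ∘ g))))

module ℤ∑ = FiniteSum ℤ.+-*-commutativeRing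
open ℤ∑ using () renaming (∑ to ∑ℤ)

module _ where
  open ≡ using (refl; sym; trans; cong)

  pos-∑ : ∀ {a} {A : Set a} (f : A → ℕ) xs → + foldr ℕ._+_ 0 (map f xs) ≡ ∑ℤ (λ x → + f x) xs
  pos-∑ f []       = refl
  pos-∑ f (x ∷ xs) = trans (ℤ.pos-+ (f x) _) (cong (λ s → + f x ℤ.+ s) (pos-∑ f xs))

  ∑ℤ-const : ∀ {a} {A : Set a} (z : ℤ) (xs : List A) → ∑ℤ (λ _ → z) xs ≡ + length xs ℤ.* z
  ∑ℤ-const z []       = refl
  ∑ℤ-const z (x ∷ xs) = trans (cong (λ s → z ℤ.+ s) (∑ℤ-const z xs)) (suc-* (+ length xs) z)
    where
    suc-* : ∀ l z → z ℤ.+ l ℤ.* z ≡ (+ 1 ℤ.+ l) ℤ.* z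
    suc-* = solve-∀

  combDeg-lookup : ∀ {m N} (a : Vec ℤ m) (v : Vec (Vec ℤ m) N) → combDeg a v ≡ ∑ℤ (λ i → a · Vec.lookup v i) (allFin N)
  combDeg-lookup a []      = refl
  combDeg-lookup a (x ∷ v) = cong (λ s → a · x ℤ.+ s) (trans (combDeg-lookup a v)
    (sym (ℤ∑.∑-tabulate (λ i → a · Vec.lookup (x ∷ v) i) Fin.suc)))

  module _ {a b} {J : Set a} {X : Set b} where

    degSum : (J → X → ℤ) → (js : List J) → Vec X (length js) → ℤ
    degSum F []       []      = + 0
    degSum F (j ∷ js) (x ∷ g) = F j x ℤ.+ degSum F js g

    degSum-lookup : ∀ (F : J → X → ℤ) js g →
                    degSum F js g ≡ ∑ℤ (λ i → F (List.lookup js i) (Vec.lookup g i)) (allFin (length js))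
    degSum-lookup F []       []      = refl
    degSum-lookup F (j ∷ js) (x ∷ g) = cong (λ s → F j x ℤ.+ s) (trans (degSum-lookup F js g)
      (sym (ℤ∑.∑-tabulate (λ i → F (List.lookup (j ∷ js) i) (Vec.lookup (x ∷ g) i)) Fin.suc)))

module LaurentAction {c ℓ : Level} (R : CommutativeRing c ℓ) (k : ℕ) .{{_ : NonZero k}}
                     (ζ : CommutativeRing.Carrier R) where
  open CommutativeRing R hiding (_-_)
  open Coeffs R k ζ using (LPoly; coeff; _⊗_; prodP)
  open FiniteSum R
  open import Relation.Binary.Reasoning.Setoid setoid

  -- (p ▷ h) e is the coefficient of q^e in p · Σₑ′ h e′ q^e′.
  _▷_ : LPoly → (ℤ → Carrier) → ℤ → Carrier
  (p ▷ h) e = ∑ (λ (a , r) → r * h (e - a)) p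

  private
    sub-+ : ∀ e a b → e - (a ℤ.+ b) ≡ e - a - b
    sub-+ = solve-∀

  δ : ℤ → Carrier
  δ e = if does (e ℤ.≟ + 0) then 1# else 0#

  *-δ : ∀ r d e → r * δ (e - d) ≈ (if does (d ℤ.≟ e) then r else 0#)
  *-δ r d e with d ℤ.≟ e | e - d ℤ.≟ + 0
  ... | yes _   | yes _     = *-identityʳ r
  ... | no _    | no _      = zeroʳ r
  ... | yes d≡e | no e-d≢0  = contradiction (ℤ.i≡j⇒i-j≡0 (≡.sym d≡e)) e-d≢0
  ... | no d≢e  | yes e-d≡0 = contradiction (≡.sym (ℤ.i-j≡0⇒i≡j e d e-d≡0)) d≢e

  coeff-as-▷ : ∀ e p → coeff e p ≈ (p ▷ δ) e
  coeff-as-▷ e p = ∑-cong p (λ {(d , r)} _ → sym (*-δ r d e))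

  ▷-cong : ∀ p {h h′ : ℤ → Carrier} → (∀ e → h e ≈ h′ e) → ∀ e → (p ▷ h) e ≈ (p ▷ h′) e
  ▷-cong p h≈h′ e = ∑-cong p (λ {(d , r)} _ → *-congˡ (h≈h′ (e - d)))

  ▷-⊗ : ∀ p q h e → ((p ⊗ q) ▷ h) e ≈ (p ▷ (q ▷ h)) e
  ▷-⊗ p q h e = begin
    ((p ⊗ q) ▷ h) e                      ≈⟨ ∑-concatMap _ _ p ⟩
    ∑ (λ (a , r) → ∑ _ (map _ q)) p      ≈⟨ ∑-cong p (λ {(a , r)} _ → row a r) ⟩
    (p ▷ (q ▷ h)) e                      ∎
    where
    row : ∀ a r → ∑ (λ (d , s) → s * h (e - d)) (map (λ (b , s) → (a ℤ.+ b , r * s)) q)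
                ≈ r * (q ▷ h) (e - a)
    row a r = begin
      ∑ _ (map _ q)                                 ≡⟨ ∑-map _ _ q ⟩
      ∑ (λ (b , s) → (r * s) * h (e - (a ℤ.+ b))) q ≈⟨ ∑-cong q (λ {(b , s)} _ → trans (*-assoc r s _)
                                                         (*-congˡ (*-congˡ (reflexive (≡.cong h (sub-+ e a b)))))) ⟩
      ∑ (λ (b , s) → r * (s * h (e - a - b))) q     ≈⟨ *-distribˡ-∑ r _ q ⟨
      r * (q ▷ h) (e - a)                           ∎

  1▷ : ∀ h e → (prodP [] ▷ h) e ≈ h e
  1▷ h e = trans (+-identityʳ _) (trans (*-identityˡ _) (reflexive (≡.cong h (ℤ.+-identityʳ e))))

  ▷-prodP : ∀ ps h e → (prodP ps ▷ h) e ≈ foldr _▷_ h ps e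
  ▷-prodP []       h e = 1▷ h e
  ▷-prodP (p ∷ ps) h e = trans (▷-⊗ p (prodP ps) h e) (▷-cong p (▷-prodP ps h) e)

  foldr-▷-cong : ∀ ps {h h′ : ℤ → Carrier} → (∀ e → h e ≈ h′ e) → ∀ e → foldr _▷_ h ps e ≈ foldr _▷_ h′ ps e
  foldr-▷-cong []       h≈h′ = h≈h′
  foldr-▷-cong (p ∷ ps) h≈h′ = ▷-cong p (foldr-▷-cong ps h≈h′)

  foldr-▷-prodP : ∀ pss h e → foldr _▷_ h (map prodP pss) e ≈ foldr _▷_ h (concat pss) e
  foldr-▷-prodP []         h e = refl
  foldr-▷-prodP (ps ∷ pss) h e = begin
    (prodP ps ▷ foldr _▷_ h (map prodP pss)) e ≈⟨ ▷-prodP ps _ e ⟩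
    foldr _▷_ (foldr _▷_ h (map prodP pss)) ps e ≈⟨ foldr-▷-cong ps (foldr-▷-prodP pss h) e ⟩
    foldr _▷_ (foldr _▷_ h (concat pss)) ps e   ≡⟨ ≡.cong (λ f → f e) (List.foldr-++ _▷_ h ps (concat pss)) ⟨
    foldr _▷_ h (ps ++ concat pss) e            ∎

  module _ {a b} {J : Set a} {X : Set b} where

    wtProd : (J → X → Carrier) → (js : List J) → Vec X (length js) → Carrier
    wtProd wt []       []      = 1#
    wtProd wt (j ∷ js) (x ∷ g) = wt j x * wtProd wt js g

    factor : (J → X → ℤ) → (J → X → Carrier) → List X → J → LPoly
    factor deg wt L j = map (λ x → (deg j x , wt j x)) L

    foldr-▷-factors : ∀ deg wt L js h e → foldr _▷_ h (map (factor deg wt L) js) e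
                    ≈ ∑ (λ g → wtProd wt js g * h (e - degSum deg js g)) (tuples L (length js))
    foldr-▷-factors deg wt L []       h e = sym (1▷ h e)
    foldr-▷-factors deg wt L (j ∷ js) h e = begin
      (factor deg wt L j ▷ H) e
        ≡⟨ ∑-map _ _ L ⟩
      ∑ (λ x → wt j x * H (e - deg j x)) L
        ≈⟨ ∑-cong L (λ {x} _ → *-congˡ (foldr-▷-factors deg wt L js h (e - deg j x))) ⟩
      ∑ (λ x → wt j x * ∑ (F x) Ts) L
        ≈⟨ ∑-cong L (λ {x} _ → *-distribˡ-∑ (wt j x) _ Ts) ⟩
      ∑ (λ x → ∑ (λ g → wt j x * F x g) Ts) L
        ≈⟨ ∑-cong L (λ {x} _ → ∑-cong Ts (λ {g} _ → regroup x g)) ⟩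
      ∑ (λ x → ∑ (G ∘ (x ∷_)) Ts) L
        ≈⟨ ∑-cong L (λ {x} _ → reflexive (∑-map G (x ∷_) Ts)) ⟨
      ∑ (λ x → ∑ G (map (x ∷_) Ts)) L
        ≈⟨ ∑-concatMap G (λ x → map (x ∷_) Ts) L ⟨
      ∑ G (tuples L (length (j ∷ js)))
        ∎
      where
      H = foldr _▷_ h (map (factor deg wt L) js)
      Ts = tuples L (length js)
      F : X → Vec X (length js) → Carrier
      F x g = wtProd wt js g * h (e - deg j x - degSum deg js g)
      G : Vec X (length (j ∷ js)) → Carrier
      G g = wtProd wt (j ∷ js) g * h (e - degSum deg (j ∷ js) g)
      regroup : ∀ x g → wt j x * F x g ≈ G (x ∷ g)
      regroup x g = trans (sym (*-assoc _ _ _))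
                          (*-congˡ (reflexive (≡.cong h (≡.sym (sub-+ e (deg j x) (degSum deg js g))))))

module RootOfUnityPowers {c ℓ : Level} (R : CommutativeRing c ℓ) (k : ℕ) .{{_ : NonZero k}}
                         (ζ : CommutativeRing.Carrier R)
                         (ζ^k≈1 : CommutativeRing._≈_ R (Coeffs.pow R k ζ ζ k) (CommutativeRing.1# R)) where
  open CommutativeRing R
  open Coeffs R k ζ using (pow; Πᴿ)
  open LaurentAction R k ζ using (wtProd)
  open ≡.≡-Reasoning

  pow-+ : ∀ x a b → pow x (a ℕ.+ b) ≈ pow x a * pow x b
  pow-+ x zero    b = sym (*-identityˡ _)
  pow-+ x (suc a) b = trans (*-congˡ (pow-+ x a b)) (sym (*-assoc _ _ _))

  pow-+-*k : ∀ a t → pow ζ (a ℕ.+ t ℕ.* k) ≈ pow ζ a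
  pow-+-*k a t = trans (pow-+ ζ a (t ℕ.* k)) (trans (*-congˡ (pow-*k t)) (*-identityʳ _))
    where
    pow-*k : ∀ t → pow ζ (t ℕ.* k) ≈ 1#
    pow-*k zero    = refl
    pow-*k (suc t) = trans (pow-+ ζ k (t ℕ.* k)) (trans (*-cong ζ^k≈1 (pow-*k t)) (*-identityˡ _))

  private
    K = + k

    -- Ring identities, quantified over K because the solver only treats variables as atoms.
    reverse-shift : ∀ b q K → b ≡ (b ℤ.+ q ℤ.* K) ℤ.+ (ℤ.- q) ℤ.* K
    reverse-shift = solve-∀
    unshift : ∀ r Q K → r ≡ (r ℤ.+ Q ℤ.* K) ℤ.- Q ℤ.* K
    unshift = solve-∀
    collect : ∀ r Q q P K → ((r ℤ.+ Q ℤ.* K) ℤ.+ q ℤ.* K) ℤ.- P ℤ.* K ≡ r ℤ.+ (Q ℤ.+ q ℤ.- P) ℤ.* K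
    collect = solve-∀
    regroup : ∀ a b c d K → (a ℤ.+ b ℤ.* K) ℤ.+ (c ℤ.+ d ℤ.* K) ≡ (a ℤ.+ c) ℤ.+ (b ℤ.+ d) ℤ.* K
    regroup = solve-∀
    expand : ∀ a b z K → (a ℤ.+ b ℤ.* K) ℤ.* z ≡ a ℤ.* z ℤ.+ (b ℤ.* z) ℤ.* K
    expand = solve-∀

    pos-shift : ∀ a b t → + a ≡ + b ℤ.+ + t ℤ.* K → a ≡ b ℕ.+ t ℕ.* k
    pos-shift a b t eq = ℤ.+-injective (begin
      + a                       ≡⟨ eq ⟩
      + b ℤ.+ + t ℤ.* K         ≡⟨ ≡.cong (λ x → + b ℤ.+ x) (ℤ.pos-* t k) ⟨
      + b ℤ.+ + (t ℕ.* k)       ≡⟨ ℤ.pos-+ b (t ℕ.* k) ⟨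
      + (b ℕ.+ t ℕ.* k)         ∎)

  pow-cong-mod : ∀ a b q → + a ≡ + b ℤ.+ q ℤ.* K → pow ζ a ≈ pow ζ b
  pow-cong-mod a b (+ t)    eq = trans (reflexive (≡.cong (pow ζ) (pos-shift a b t eq))) (pow-+-*k b t)
  pow-cong-mod a b -[1+ t ] eq = sym (trans (reflexive (≡.cong (pow ζ) (pos-shift b a (suc t) b≡))) (pow-+-*k a (suc t)))
    where
    b≡ : + b ≡ + a ℤ.+ + suc t ℤ.* K
    b≡ = ≡.trans (reverse-shift (+ b) -[1+ t ] K) (≡.cong (λ x → x ℤ.+ + suc t ℤ.* K) (≡.sym eq))

  -- Reducing the exponent mod k is harmless because ζ^k ≈ 1.
  ζ^ : ℤ → Carrier
  ζ^ z = pow ζ (z %ℕ k)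

  ζ^-cong-mod : ∀ x y q → x ≡ y ℤ.+ q ℤ.* K → ζ^ x ≈ ζ^ y
  ζ^-cong-mod x y q eq = pow-cong-mod (x %ℕ k) (y %ℕ k) (y /ℕ k ℤ.+ q ℤ.- x /ℕ k) (begin
    + (x %ℕ k)
      ≡⟨ unshift (+ (x %ℕ k)) (x /ℕ k) K ⟩
    (+ (x %ℕ k) ℤ.+ x /ℕ k ℤ.* K) ℤ.- x /ℕ k ℤ.* K
      ≡⟨ ≡.cong (ℤ._- x /ℕ k ℤ.* K) (a≡a%ℕn+[a/ℕn]*n x k) ⟨
    x ℤ.- x /ℕ k ℤ.* K
      ≡⟨ ≡.cong (ℤ._- x /ℕ k ℤ.* K) eq ⟩
    (y ℤ.+ q ℤ.* K) ℤ.- x /ℕ k ℤ.* K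
      ≡⟨ ≡.cong (λ w → (w ℤ.+ q ℤ.* K) ℤ.- x /ℕ k ℤ.* K) (a≡a%ℕn+[a/ℕn]*n y k) ⟩
    ((+ (y %ℕ k) ℤ.+ y /ℕ k ℤ.* K) ℤ.+ q ℤ.* K) ℤ.- x /ℕ k ℤ.* K
      ≡⟨ collect (+ (y %ℕ k)) (y /ℕ k) q (x /ℕ k) K ⟩
    + (y %ℕ k) ℤ.+ (y /ℕ k ℤ.+ q ℤ.- x /ℕ k) ℤ.* K
      ∎)

  ζ^-pos : ∀ a → ζ^ (+ a) ≈ pow ζ a
  ζ^-pos a = sym (trans (reflexive (≡.cong (pow ζ) (ℕ.m≡m%n+[m/n]*n a k))) (pow-+-*k (a ℕ.% k) (a ℕ./ k)))

  ζ^-0 : ζ^ (+ 0) ≈ 1#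
  ζ^-0 = ζ^-pos 0

  ζ^-+ : ∀ x y → ζ^ (x ℤ.+ y) ≈ ζ^ x * ζ^ y
  ζ^-+ x y = trans (ζ^-cong-mod (x ℤ.+ y) (+ (x %ℕ k ℕ.+ y %ℕ k)) (x /ℕ k ℤ.+ y /ℕ k) x+y≡)
                   (trans (ζ^-pos (x %ℕ k ℕ.+ y %ℕ k)) (pow-+ ζ (x %ℕ k) (y %ℕ k)))
    where
    x+y≡ : x ℤ.+ y ≡ + (x %ℕ k ℕ.+ y %ℕ k) ℤ.+ (x /ℕ k ℤ.+ y /ℕ k) ℤ.* K
    x+y≡ = begin
      x ℤ.+ y
        ≡⟨ ≡.cong₂ ℤ._+_ (a≡a%ℕn+[a/ℕn]*n x k) (a≡a%ℕn+[a/ℕn]*n y k) ⟩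
      (+ (x %ℕ k) ℤ.+ x /ℕ k ℤ.* K) ℤ.+ (+ (y %ℕ k) ℤ.+ y /ℕ k ℤ.* K)
        ≡⟨ regroup (+ (x %ℕ k)) (x /ℕ k) (+ (y %ℕ k)) (y /ℕ k) K ⟩
      (+ (x %ℕ k) ℤ.+ + (y %ℕ k)) ℤ.+ (x /ℕ k ℤ.+ y /ℕ k) ℤ.* K
        ≡⟨ ≡.cong (ℤ._+ (x /ℕ k ℤ.+ y /ℕ k) ℤ.* K) (ℤ.pos-+ (x %ℕ k) (y %ℕ k)) ⟨
      + (x %ℕ k ℕ.+ y %ℕ k) ℤ.+ (x /ℕ k ℤ.+ y /ℕ k) ℤ.* K
        ∎

  ζ^-mod : ∀ N z → ζ^ (+ toℕ (N ℕ.mod k) ℤ.* z) ≈ ζ^ (+ N ℤ.* z)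
  ζ^-mod N z = sym (ζ^-cong-mod (+ N ℤ.* z) (+ r ℤ.* z) (+ (N ℕ./ k) ℤ.* z) (begin
    + N ℤ.* z                               ≡⟨ ≡.cong (λ n → + n ℤ.* z) N≡ ⟩
    + (r ℕ.+ N ℕ./ k ℕ.* k) ℤ.* z           ≡⟨ ≡.cong (ℤ._* z) (ℤ.pos-+ r _) ⟩
    (+ r ℤ.+ + (N ℕ./ k ℕ.* k)) ℤ.* z       ≡⟨ ≡.cong (λ x → (+ r ℤ.+ x) ℤ.* z) (ℤ.pos-* (N ℕ./ k) k) ⟩
    (+ r ℤ.+ + (N ℕ./ k) ℤ.* K) ℤ.* z       ≡⟨ expand (+ r) (+ (N ℕ./ k)) z K ⟩
    + r ℤ.* z ℤ.+ (+ (N ℕ./ k) ℤ.* z) ℤ.* K ∎))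
    where
    r = toℕ (N ℕ.mod k)
    N≡ : N ≡ r ℕ.+ N ℕ./ k ℕ.* k
    N≡ = ≡.trans (ℕ.m≡m%n+[m/n]*n N k) (≡.cong (ℕ._+ N ℕ./ k ℕ.* k) (≡.sym (Fin.toℕ-fromℕ< (ℕ.m%n<n N k))))

  ζ^-∑ : ∀ {N} (h : Fin N → ℤ) → Πᴿ (List.tabulate (ζ^ ∘ h)) ≈ ζ^ (∑ℤ h (allFin N))
  ζ^-∑ {zero}  h = sym ζ^-0
  ζ^-∑ {suc N} h = trans (*-congˡ (ζ^-∑ (h ∘ Fin.suc))) (trans (sym (ζ^-+ (h Fin.zero) _))
                     (reflexive (≡.cong (λ s → ζ^ (h Fin.zero ℤ.+ s)) (≡.sym (ℤ∑.∑-tabulate h Fin.suc)))))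

  wtProd-ζ^ : ∀ {a b} {J : Set a} {X : Set b} (F : J → X → ℤ) (wt : J → X → Carrier) →
              (∀ j x → wt j x ≈ ζ^ (F j x)) → ∀ js g → wtProd wt js g ≈ ζ^ (degSum F js g)
  wtProd-ζ^ F wt wt≈ []       []      = sym ζ^-0
  wtProd-ζ^ F wt wt≈ (j ∷ js) (x ∷ g) = trans (*-cong (wt≈ j x) (wtProd-ζ^ F wt wt≈ js g)) (sym (ζ^-+ (F j x) _))

module Cycles {k n : ℕ} (σ : Wreath k n) where
  open ≡ using (refl; sym; trans; cong)

  private
    π = perm σ

  iter-+ : ∀ s t i → iter σ (s ℕ.+ t) i ≡ iter σ s (iter σ t i)
  iter-+ zero    t i = refl
  iter-+ (suc s) t i = cong (π ⟨$⟩ʳ_) (iter-+ s t i)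

  iter-injective : ∀ s {i j} → iter σ s i ≡ iter σ s j → i ≡ j
  iter-injective zero    eq = eq
  iter-injective (suc s) eq = iter-injective s (Injection.injective (Inverse⇒Injection π) eq)

  iter-∸ : ∀ {s t} i → s ≤ t → iter σ s i ≡ iter σ t i → iter σ (t ℕ.∸ s) i ≡ i
  iter-∸ {s} {t} i s≤t eq = sym (iter-injective s (begin
    iter σ s i                      ≡⟨ eq ⟩
    iter σ t i                      ≡⟨ cong (λ u → iter σ u i) (ℕ.m+[n∸m]≡n s≤t) ⟨
    iter σ (s ℕ.+ (t ℕ.∸ s)) i      ≡⟨ iter-+ s (t ℕ.∸ s) i ⟩
    iter σ s (iter σ (t ℕ.∸ s) i)   ∎))
    where open ≡.≡-Reasoning

  -- Pigeonhole on i, σ i, …, σⁿ i.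
  returns-within : ∀ i → ∃ λ d → 0 < d × d ≤ n × iter σ d i ≡ i
  returns-within i with Fin.pigeonhole (ℕ.n<1+n n) (λ s → iter σ (toℕ s) i)
  ... | a , b , a<b , eq = toℕ b ℕ.∸ toℕ a , ℕ.m<n⇒0<n∸m a<b ,
                           ℕ.≤-trans (ℕ.m∸n≤m (toℕ b) (toℕ a)) (ℕ.≤-pred (Fin.toℕ<n b)) ,
                           iter-∸ i (ℕ.<⇒≤ a<b) eq

  module _ (i : Fin n) where
    private
      notBack : Fin n → Bool
      notBack j = not (eqFin j i)
      ℓ = length (takeWhileᵇ notBack (applyUpTo (λ s → iter σ (suc s) i) n))

      cycLen≡ : cycLen σ i ≡ suc ℓ
      cycLen≡ = cong (λ xs → suc (length (takeWhileᵇ notBack xs))) (List.map-upTo (λ s → iter σ (suc s) i) n)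

      no-early-return : ∀ {s} → s < ℓ → iter σ (suc s) i ≢ i
      no-early-return s<ℓ eq =
        ≡.subst (T ∘ not) (dec-true (i Fin.≟ i) refl) (≡.subst (T ∘ notBack) eq (takeWhileᵇ-holds notBack _ n s<ℓ))

      ℓ<n : ℓ < n
      ℓ<n with ℕ.m≤n⇒m<n∨m≡n (length-takeWhileᵇ-≤ notBack (λ s → iter σ (suc s) i) n)
      ... | inj₁ ℓ<n = ℓ<n
      ... | inj₂ ℓ≡n with returns-within i
      ...   | suc d , _ , d<n , eq = contradiction eq (no-early-return (≡.subst (d <_) (sym ℓ≡n) d<n))

    iter-cycLen : iter σ (cycLen σ i) i ≡ i
    iter-cycLen = ≡.subst (λ L → iter σ L i ≡ i) (sym cycLen≡) returns
      where
      returns : iter σ (suc ℓ) i ≡ i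
      returns with iter σ (suc ℓ) i Fin.≟ i | takeWhileᵇ-stops notBack _ n ℓ<n
      ... | yes eq | _    = eq
      ... | no  _  | stop = contradiction _ stop

    cycLen-minimal : ∀ {s} → 0 < s → s < cycLen σ i → iter σ s i ≢ i
    cycLen-minimal {suc s} _ s<L = no-early-return (ℕ.≤-pred (≡.subst (suc s <_) cycLen≡ s<L))

  iter-*cycLen : ∀ q i → iter σ (q ℕ.* cycLen σ i) i ≡ i
  iter-*cycLen zero    i = refl
  iter-*cycLen (suc q) i = trans (iter-+ (cycLen σ i) (q ℕ.* cycLen σ i) i)
                                 (trans (cong (iter σ (cycLen σ i)) (iter-*cycLen q i)) (iter-cycLen i))

  iter-%cycLen : ∀ s i → iter σ s i ≡ iter σ (s ℕ.% cycLen σ i) i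
  iter-%cycLen s i = trans (cong (λ u → iter σ u i) (ℕ.m≡m%n+[m/n]*n s L))
                           (trans (iter-+ (s ℕ.% L) _ i) (cong (iter σ (s ℕ.% L)) (iter-*cycLen (s ℕ./ L) i)))
    where L = cycLen σ i

  SameCycle : Fin n → Fin n → Set
  SameCycle i j = ∃ λ s → iter σ s i ≡ j

  SameCycle-refl : ∀ {i} → SameCycle i i
  SameCycle-refl = 0 , refl

  SameCycle-trans : ∀ {i j l} → SameCycle i j → SameCycle j l → SameCycle i l
  SameCycle-trans {i} (s , refl) (t , refl) = t ℕ.+ s , iter-+ t s i

  -- Going backwards by s is going forwards by s (cycLen − 1) steps.
  SameCycle-sym : ∀ {i j} → SameCycle i j → SameCycle j i
  SameCycle-sym {i} (s , refl) = s ℕ.* cycLen σ i ℕ.∸ s ,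
    trans (sym (iter-+ (s ℕ.* cycLen σ i ℕ.∸ s) s i))
          (trans (cong (λ u → iter σ u i) (ℕ.m∸n+n≡m (ℕ.m≤m*n s (cycLen σ i)))) (iter-*cycLen s i))

  SameCycle-⟨$⟩ˡ : ∀ j → SameCycle (π ⟨$⟩ˡ j) j
  SameCycle-⟨$⟩ˡ j = 1 , inverseʳ π

  orbit≡ : ∀ i → orbit σ i ≡ applyUpTo (λ s → iter σ s i) (cycLen σ i)
  orbit≡ i = List.map-upTo (λ s → iter σ s i) (cycLen σ i)

  ∈-orbit⁺ : ∀ {i j} → SameCycle i j → j ∈ orbit σ i
  ∈-orbit⁺ {i} (s , refl) rewrite orbit≡ i | iter-%cycLen s i =
    ∈-applyUpTo⁺ (λ s → iter σ s i) (ℕ.m%n<n s (cycLen σ i))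

  ∈-orbit⁻ : ∀ i {j} → j ∈ orbit σ i → SameCycle i j
  ∈-orbit⁻ i j∈ rewrite orbit≡ i with ∈-applyUpTo⁻ (λ s → iter σ s i) j∈
  ... | s , _ , eq = s , sym eq

  orbit-unique : ∀ i → Unique (orbit σ i)
  orbit-unique i rewrite orbit≡ i = Unique.applyUpTo⁺₁ (λ s → iter σ s i) (cycLen σ i) distinct
    where
    distinct : ∀ {s t} → s < t → t < cycLen σ i → iter σ s i ≢ iter σ t i
    distinct {s} {t} s<t t<L eq = cycLen-minimal i (ℕ.m<n⇒0<n∸m s<t) (ℕ.≤-<-trans (ℕ.m∸n≤m t s) t<L)
                                    (iter-∸ i (ℕ.<⇒≤ s<t) eq)

  length-orbit : ∀ i → length (orbit σ i) ≡ cycLen σ i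
  length-orbit i = trans (cong length (orbit≡ i)) (List.length-applyUpTo (λ s → iter σ s i) (cycLen σ i))

  isRep⁺ : ∀ r → (∀ {j} → j ∈ orbit σ r → toℕ r ≤ toℕ j) → T (isRep σ r)
  isRep⁺ r = go (orbit σ r)
    where
    go : ∀ js → (∀ {j} → j ∈ js → toℕ r ≤ toℕ j) → T (foldr (λ j b → does (toℕ r ℕ.≤? toℕ j) ∧ b) true js)
    go []       _   = _
    go (j ∷ js) min = Equivalence.from (T-∧ {toℕ r ℕ.≤ᵇ toℕ j}) (ℕ.≤⇒≤ᵇ (min (here refl)) , go js (min ∘ there))

  isRep⁻ : ∀ {r j} → T (isRep σ r) → SameCycle r j → toℕ r ≤ toℕ j
  isRep⁻ {r} rep r~j = go (orbit σ r) rep (∈-orbit⁺ r~j)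
    where
    go : ∀ js → T (foldr (λ j b → does (toℕ r ℕ.≤? toℕ j) ∧ b) true js) → ∀ {j} → j ∈ js → toℕ r ≤ toℕ j
    go (j ∷ js) min (here refl)  = ℕ.≤ᵇ⇒≤ _ _ (proj₁ (Equivalence.to (T-∧ {toℕ r ℕ.≤ᵇ toℕ j}) min))
    go (j ∷ js) min (there j∈js) = go js (proj₂ (Equivalence.to (T-∧ {toℕ r ℕ.≤ᵇ toℕ j}) min)) j∈js

  isRep-unique : ∀ {r r′} → T (isRep σ r) → T (isRep σ r′) → SameCycle r r′ → r ≡ r′
  isRep-unique rep rep′ r~r′ =
    Fin.toℕ-injective (ℕ.≤-antisym (isRep⁻ rep r~r′) (isRep⁻ rep′ (SameCycle-sym r~r′)))

  -- Opaque: argmin over an orbit has a huge normal form that unification must not unfold.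
  opaque
    rep : Fin n → Fin n
    rep i = Extrema.argmin toℕ i (orbit σ i)

    SameCycle-rep : ∀ i → SameCycle i (rep i)
    SameCycle-rep i = [ (λ rep≡i → 0 , sym rep≡i) , ∈-orbit⁻ i ]′ (Extrema.argmin-sel toℕ i (orbit σ i))

    isRep-rep : ∀ i → T (isRep σ (rep i))
    isRep-rep i = isRep⁺ (rep i) λ {j} j∈ → All.lookup (Extrema.f[argmin]≤f[xs] {f = toℕ} i (orbit σ i))
                                                      (∈-orbit⁺ (SameCycle-trans (SameCycle-rep i) (∈-orbit⁻ (rep i) j∈)))

  module _ .{{_ : NonZero k}} where

    isRepOfClass : Fin k → Fin n → Bool
    isRepOfClass j i = isRep σ i ∧ eqFin (cycClass σ i) j

    -- One representative per cycle, grouped by class as in cycleType.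
    cycleReps : List (Fin n)
    cycleReps = concatMap (λ j → filterᵇ (isRepOfClass j) (allFin n)) (allFin k)

    ∈-cycleReps⁺ : ∀ {r} → T (isRep σ r) → r ∈ cycleReps
    ∈-cycleReps⁺ {r} rep = ∈-concatMap⁺ (λ j → filterᵇ (isRepOfClass j) (allFin n))
      (Any.map (λ { refl → ∈-filter⁺ (T? ∘ isRepOfClass (cycClass σ r)) (∈-allFin r)
                             (Equivalence.from T-∧ (rep , to-T-does (cycClass σ r Fin.≟ cycClass σ r) refl)) })
               (∈-allFin (cycClass σ r)))

    ∈-cycleReps⁻ : ∀ {r} → r ∈ cycleReps → T (isRep σ r)
    ∈-cycleReps⁻ r∈ with find (∈-concatMap⁻ (λ j → filterᵇ (isRepOfClass j) (allFin n)) {xs = allFin k} r∈)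
    ... | j , _ , r∈j = proj₁ (Equivalence.to T-∧ (proj₂ (∈-filter⁻ (T? ∘ isRepOfClass j) {xs = allFin n} r∈j)))

    cycleReps-unique : Unique cycleReps
    cycleReps-unique = concatMap-unique (Unique.allFin⁺ k)
      (λ j → Unique.filter⁺ (T? ∘ isRepOfClass j) (Unique.allFin⁺ n)) same-class
      where
      class≡ : ∀ {j r} → r ∈ filterᵇ (isRepOfClass j) (allFin n) → cycClass σ r ≡ j
      class≡ {j} {r} r∈j = from-T-does (cycClass σ r Fin.≟ j)
        (proj₂ (Equivalence.to (T-∧ {isRep σ r}) (proj₂ (∈-filter⁻ (T? ∘ isRepOfClass j) {xs = allFin n} r∈j))))
      same-class : ∀ {j j′ r} → r ∈ filterᵇ (isRepOfClass j) (allFin n) → r ∈ filterᵇ (isRepOfClass j′) (allFin n) →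
                   j ≡ j′
      same-class r∈j r∈j′ = trans (sym (class≡ r∈j)) (class≡ r∈j′)

    #cycles : ℕ
    #cycles = length cycleReps

    cycleRep : Fin #cycles → Fin n
    cycleRep = List.lookup cycleReps

    opaque
      cycleOf : Fin n → Fin #cycles
      cycleOf i = Any.index (∈-cycleReps⁺ (isRep-rep i))

      SameCycle-cycleRep : ∀ i → SameCycle (cycleRep (cycleOf i)) i
      SameCycle-cycleRep i =
        ≡.subst (λ r → SameCycle r i) (Any.lookup-index (∈-cycleReps⁺ (isRep-rep i))) (SameCycle-sym (SameCycle-rep i))

      cycleOf-unique : ∀ {j i} → SameCycle (cycleRep j) i → j ≡ cycleOf i
      cycleOf-unique {j} {i} rⱼ~i = lookup-injective cycleReps-unique (trans
        (isRep-unique (∈-cycleReps⁻ (∈-lookup j)) (isRep-rep i) (SameCycle-trans rⱼ~i (SameCycle-rep i)))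
        (Any.lookup-index (∈-cycleReps⁺ (isRep-rep i))))

    cycleOf-cycleRep : ∀ j → cycleOf (cycleRep j) ≡ j
    cycleOf-cycleRep j = sym (cycleOf-unique SameCycle-refl)

    cycleOf-cong : ∀ {i i′} → SameCycle i i′ → cycleOf i ≡ cycleOf i′
    cycleOf-cong {i} i~i′ = cycleOf-unique (SameCycle-trans (SameCycle-cycleRep i) i~i′)

    orbits-unique : Unique (concatMap (orbit σ ∘ cycleRep) (allFin #cycles))
    orbits-unique = concatMap-unique {f = orbit σ ∘ cycleRep} {xs = allFin #cycles}
                                     (Unique.allFin⁺ #cycles) (orbit-unique ∘ cycleRep) disjoint
      where
      disjoint : ∀ {j j′ s} → s ∈ orbit σ (cycleRep j) → s ∈ orbit σ (cycleRep j′) → j ≡ j′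
      disjoint {j} {j′} {s} s∈ s∈′ = trans (cycleOf-unique {j} {s} (∈-orbit⁻ (cycleRep j) s∈))
                                           (sym (cycleOf-unique {j′} {s} (∈-orbit⁻ (cycleRep j′) s∈′)))

    ∈-orbits : ∀ i → i ∈ concatMap (orbit σ ∘ cycleRep) (allFin #cycles)
    ∈-orbits i = ∈-concatMap⁺ (orbit σ ∘ cycleRep)
      (Any.map (λ { refl → ∈-orbit⁺ (SameCycle-cycleRep i) }) (∈-allFin (cycleOf i)))

    module _ {c ℓ : Level} (R : CommutativeRing c ℓ) where
      open CommutativeRing R using (Carrier; _≈_; reflexive)
      open FiniteSum R
      open import Relation.Binary.Reasoning.Setoid (CommutativeRing.setoid R)

      ∑-by-cycles : ∀ (F : Fin n → Fin #cycles → Carrier) →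
                    ∑ (λ i → F i (cycleOf i)) (allFin n) ≈ ∑ (λ j → ∑ (λ s → F s j) (orbit σ (cycleRep j))) (allFin #cycles)
      ∑-by-cycles F = begin
        ∑ G (allFin n)
          ≈⟨ ∑-same-elements Fin._≟_ G (Unique.allFin⁺ n) orbits-unique (λ {i} _ → ∈-orbits i) (λ {i} _ → ∈-allFin i) ⟩
        ∑ G (concatMap (orbit σ ∘ cycleRep) (allFin #cycles))
          ≈⟨ ∑-concatMap G (orbit σ ∘ cycleRep) (allFin #cycles) ⟩
        ∑ (λ j → ∑ G (orbit σ (cycleRep j))) (allFin #cycles)
          ≈⟨ ∑-cong (allFin #cycles) (λ {j} _ → ∑-cong (orbit σ (cycleRep j)) λ {s} s∈ →
               reflexive (cong (F s) (sym (cycleOf-unique {j} {s} (∈-orbit⁻ (cycleRep j) s∈))))) ⟩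
        ∑ (λ j → ∑ (λ s → F s j) (orbit σ (cycleRep j))) (allFin #cycles)
          ∎
        where
        G : Fin n → Carrier
        G i = F i (cycleOf i)

module CycleConstant {k n : ℕ} .{{_ : NonZero k}} (σ : Wreath k n) where
  open ≡ using (refl; sym; trans; cong)
  open Cycles σ

  module _ {x} {X : Set x} where

    spread : Vec X #cycles → Vec X n
    spread g = Vec.tabulate (Vec.lookup g ∘ cycleOf)

    restrict : Vec X n → Vec X #cycles
    restrict v = Vec.tabulate (Vec.lookup v ∘ cycleRep)

    restrict-spread : ∀ g → restrict (spread g) ≡ g
    restrict-spread g = trans (Vec.tabulate-cong λ j → trans (Vec.lookup∘tabulate (Vec.lookup g ∘ cycleOf) (cycleRep j))
                                                           (cong (Vec.lookup g) (cycleOf-cycleRep j)))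
                              (Vec.tabulate∘lookup g)

    spread-injective : ∀ {g g′} → spread g ≡ spread g′ → g ≡ g′
    spread-injective {g} {g′} eq = trans (sym (restrict-spread g)) (trans (cong restrict eq) (restrict-spread g′))

    spread-∈ : ∀ {L g} → g ∈ tuples L #cycles → spread g ∈ tuples L n
    spread-∈ {L} {g} g∈ = ∈-tuples⁺ (spread g) λ i →
      ≡.subst (_∈ L) (sym (Vec.lookup∘tabulate (Vec.lookup g ∘ cycleOf) i)) (∈-tuples⁻ g∈ (cycleOf i))

    restrict-∈ : ∀ {L v} → v ∈ tuples L n → restrict v ∈ tuples L #cycles
    restrict-∈ {L} {v} v∈ = ∈-tuples⁺ (restrict v) λ j →
      ≡.subst (_∈ L) (sym (Vec.lookup∘tabulate (Vec.lookup v ∘ cycleRep) j)) (∈-tuples⁻ v∈ (cycleRep j))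

  module _ {m : ℕ} where

    actMon-spread : ∀ (g : Vec (Vec ℤ m) #cycles) → actMon σ (spread g) ≡ spread g
    actMon-spread g = Vec.tabulate-cong λ j → trans (Vec.lookup∘tabulate (Vec.lookup g ∘ cycleOf) (perm σ ⟨$⟩ˡ j))
                                                   (cong (Vec.lookup g) (cycleOf-cong (SameCycle-⟨$⟩ˡ j)))

    module _ {v : Vec (Vec ℤ m) n} (fixed : actMon σ v ≡ v) where

      lookup-SameCycle : ∀ {i j} → SameCycle i j → Vec.lookup v j ≡ Vec.lookup v i
      lookup-SameCycle {i} (zero  , refl) = refl
      lookup-SameCycle {i} (suc s , refl) = trans step (lookup-SameCycle (s , refl))
        where
        step : Vec.lookup v (perm σ ⟨$⟩ʳ iter σ s i) ≡ Vec.lookup v (iter σ s i)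
        step = trans (cong (λ w → Vec.lookup w (perm σ ⟨$⟩ʳ iter σ s i)) (sym fixed))
                     (trans (Vec.lookup∘tabulate _ (perm σ ⟨$⟩ʳ iter σ s i)) (cong (Vec.lookup v) (inverseˡ (perm σ))))

      spread-restrict : spread (restrict v) ≡ v
      spread-restrict = trans (Vec.tabulate-cong λ i → trans (Vec.lookup∘tabulate (Vec.lookup v ∘ cycleRep) (cycleOf i))
                                                              (sym (lookup-SameCycle (SameCycle-cycleRep i))))
                              (Vec.tabulate∘lookup v)

    isFixed : Vec (Vec ℤ m) n → Bool
    isFixed v = eqMon (actMon σ v) v

    private
      _≟ᵗ_ : DecidableEquality (Vec (Vec ℤ m) n)
      _≟ᵗ_ = Vec.≡-dec (Vec.≡-dec ℤ._≟_)

    module _ (P : Vec (Vec ℤ m) n → Bool) (L : List (Vec ℤ m)) where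

      fixed⇒spread : ∀ {v} → v ∈ filterᵇ isFixed (filterᵇ P (tuples L n)) →
                     v ∈ map spread (filterᵇ (P ∘ spread) (tuples L #cycles))
      fixed⇒spread {v} v∈ =
        let v∈P , v-fixed = ∈-filter⁻ (T? ∘ isFixed) {xs = filterᵇ P (tuples L n)} v∈
            v∈L , Pv      = ∈-filter⁻ (T? ∘ P) {xs = tuples L n} v∈P
            v≡            = spread-restrict (from-T-does (actMon σ v ≟ᵗ v) v-fixed)
        in ≡.subst (_∈ map spread (filterᵇ (P ∘ spread) (tuples L #cycles))) v≡
             (∈-map⁺ spread (∈-filter⁺ (T? ∘ P ∘ spread) (restrict-∈ v∈L) (≡.subst (T ∘ P) (sym v≡) Pv)))

      spread⇒fixed : ∀ {v} → v ∈ map spread (filterᵇ (P ∘ spread) (tuples L #cycles)) →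
                     v ∈ filterᵇ isFixed (filterᵇ P (tuples L n))
      spread⇒fixed v∈ with ∈-map⁻ spread v∈
      ... | g , g∈ , refl =
        let g∈L , Pg = ∈-filter⁻ (T? ∘ P ∘ spread) {xs = tuples L #cycles} g∈
        in ∈-filter⁺ (T? ∘ isFixed) (∈-filter⁺ (T? ∘ P) (spread-∈ g∈L) Pg)
                     (to-T-does (actMon σ (spread g) ≟ᵗ spread g) (actMon-spread g))

      fixed-unique : Unique L → Unique (filterᵇ isFixed (filterᵇ P (tuples L n)))
      fixed-unique L! = Unique.filter⁺ (T? ∘ isFixed) (Unique.filter⁺ (T? ∘ P) (tuples-unique L! n))

      spread-unique : Unique L → Unique (map spread (filterᵇ (P ∘ spread) (tuples L #cycles)))
      spread-unique L! = Unique.map⁺ spread-injective (Unique.filter⁺ (T? ∘ P ∘ spread) (tuples-unique L! #cycles))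

module TraceFormula {c ℓ : Level} (R : CommutativeRing c ℓ) (k : ℕ) .{{_ : NonZero k}}
                    (ζ : CommutativeRing.Carrier R) {m n : ℕ} (σ : Wreath k n) (a′ : Vec ℤ m) (Ld : List (Vec ℤ m)) where
  open CommutativeRing R hiding (_-_)
  open Coeffs R k ζ
  open FiniteSum R
  open LaurentAction R k ζ
  open Cycles σ
  open CycleConstant σ
  private module ≈-Reasoning = Relation.Binary.Reasoning.Setoid setoid

  cycleDeg : Fin n → Vec ℤ m → ℤ
  cycleDeg r x = + cycLen σ r ℤ.* (a′ · x)

  cycleWt : Fin n → Vec ℤ m → Carrier
  cycleWt r x = upow (cycClass σ r) ∣ x ∣ᵥ

  -- The common value of both sides: a sum over one lattice point per cycle.
  cycleSum : ℤ → Carrier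
  cycleSum e = ∑ (λ g → if does (degSum cycleDeg cycleReps g ℤ.≟ e) then wtProd cycleWt cycleReps g else 0#)
                 (tuples Ld #cycles)

  -- The factor of rhsPoly contributed by a cycle of length len in class i.
  classFactor : ℕ → Fin k → LPoly
  classFactor len i = map (λ v → (+ len ℤ.* (a′ · v) , upow i ∣ v ∣ᵥ)) Ld

  cycleType-factors : concat (map (λ i → map (λ len → classFactor len i) (cycleType σ i)) (allFin k))
                    ≡ map (factor cycleDeg cycleWt Ld) cycleReps
  cycleType-factors = begin
    concat (map (λ i → map (λ len → classFactor len i) (cycleType σ i)) (allFin k))
      ≡⟨ ≡.cong concat (List.map-cong per-class (allFin k)) ⟩
    concat (map (map (factor cycleDeg cycleWt Ld) ∘ reps) (allFin k))
      ≡⟨ ≡.cong concat (List.map-∘ (allFin k)) ⟩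
    concat (map (map (factor cycleDeg cycleWt Ld)) (map reps (allFin k)))
      ≡⟨ List.concat-map (map reps (allFin k)) ⟩
    map (factor cycleDeg cycleWt Ld) cycleReps
      ∎
    where
    open ≡.≡-Reasoning
    reps : Fin k → List (Fin n)
    reps j = filterᵇ (isRepOfClass j) (allFin n)
    per-class : ∀ j → map (λ len → classFactor len j) (cycleType σ j) ≡ map (factor cycleDeg cycleWt Ld) (reps j)
    per-class j = ≡.trans (≡.sym (List.map-∘ (reps j))) (List.map-cong-local (All.map
      (λ {r} r∈j → ≡.cong (classFactor (cycLen σ r))
                          (≡.sym (from-T-does (cycClass σ r Fin.≟ j) (proj₂ (Equivalence.to T-∧ r∈j)))))
      (All.all-filter (T? ∘ isRepOfClass j) (allFin n))))

  rhs≈cycleSum : ∀ e → coeff e (rhsPoly a′ Ld (cycleType σ)) ≈ cycleSum e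
  rhs≈cycleSum e = begin
    coeff e (rhsPoly a′ Ld (cycleType σ))                      ≡⟨ ≡.cong (coeff e ∘ prodP) (List.map-∘ (allFin k)) ⟩
    coeff e (prodP (map prodP pss))                            ≈⟨ coeff-as-▷ e (prodP (map prodP pss)) ⟩
    (prodP (map prodP pss) ▷ δ) e                              ≈⟨ ▷-prodP (map prodP pss) δ e ⟩
    foldr _▷_ δ (map prodP pss) e                              ≈⟨ foldr-▷-prodP pss δ e ⟩
    foldr _▷_ δ (concat pss) e                                 ≡⟨ ≡.cong (λ ps → foldr _▷_ δ ps e) cycleType-factors ⟩
    foldr _▷_ δ (map (factor cycleDeg cycleWt Ld) cycleReps) e ≈⟨ foldr-▷-factors cycleDeg cycleWt Ld cycleReps δ e ⟩
    ∑ (λ g → wtProd cycleWt cycleReps g * δ (e - degSum cycleDeg cycleReps g)) (tuples Ld #cycles)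
                                                               ≈⟨ ∑-cong (tuples Ld #cycles) (λ {g} _ →
                                                                    *-δ _ (degSum cycleDeg cycleReps g) e) ⟩
    cycleSum e                                                 ∎
    where
    open ≈-Reasoning
    pss = map (λ i → map (λ len → classFactor len i) (cycleType σ i)) (allFin k)

  combDeg-spread : ∀ g → combDeg a′ (spread g) ≡ degSum cycleDeg cycleReps g
  combDeg-spread g = begin
    combDeg a′ (spread g)
      ≡⟨ combDeg-lookup a′ (spread g) ⟩
    ∑ℤ (λ i → a′ · Vec.lookup (spread g) i) (allFin n)
      ≡⟨ ℤ∑.∑-cong (allFin n) (λ {i} _ → ≡.cong (a′ ·_) (Vec.lookup∘tabulate (Vec.lookup g ∘ cycleOf) i)) ⟩
    ∑ℤ (λ i → a′ · Vec.lookup g (cycleOf i)) (allFin n)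
      ≡⟨ ∑-by-cycles ℤ.+-*-commutativeRing (λ _ j → a′ · Vec.lookup g j) ⟩
    ∑ℤ (λ j → ∑ℤ (λ _ → a′ · Vec.lookup g j) (orbit σ (cycleRep j))) (allFin #cycles)
      ≡⟨ ℤ∑.∑-cong (allFin #cycles) (λ {j} _ → ≡.trans (∑ℤ-const _ (orbit σ (cycleRep j)))
                                                  (≡.cong (λ l → + l ℤ.* (a′ · Vec.lookup g j)) (length-orbit (cycleRep j)))) ⟩
    ∑ℤ (λ j → cycleDeg (cycleRep j) (Vec.lookup g j)) (allFin #cycles)
      ≡⟨ degSum-lookup cycleDeg cycleReps g ⟨
    degSum cycleDeg cycleReps g
      ∎
    where open ≡.≡-Reasoning

  module _ (ζ^k≈1 : pow ζ k ≈ 1#) where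
    open RootOfUnityPowers R k ζ ζ^k≈1

    rootSum : Fin n → ℕ
    rootSum r = foldr ℕ._+_ 0 (map (λ j → toℕ (roots σ j)) (orbit σ r))

    weight : Vec (Vec ℤ m) n → Carrier
    weight v = Πᴿ (List.tabulate (λ i → upow (roots σ i) ∣ Vec.lookup v i ∣ᵥ))

    weight-spread : ∀ g → weight (spread g) ≈ wtProd cycleWt cycleReps g
    weight-spread g = begin
      weight (spread g)
        ≡⟨ ≡.cong Πᴿ (List.tabulate-cong λ i →
             ≡.cong (λ x → upow (roots σ i) ∣ x ∣ᵥ) (Vec.lookup∘tabulate (Vec.lookup g ∘ cycleOf) i)) ⟩
      Πᴿ (List.tabulate (ζ^ ∘ h))
        ≈⟨ ζ^-∑ h ⟩
      ζ^ (∑ℤ h (allFin n))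
        ≡⟨ ≡.cong ζ^ grouped ⟩
      ζ^ (degSum (λ r x → + rootSum r ℤ.* ∣ x ∣ᵥ) cycleReps g)
        ≈⟨ wtProd-ζ^ _ cycleWt (λ r x → ζ^-mod (rootSum r) ∣ x ∣ᵥ) cycleReps g ⟨
      wtProd cycleWt cycleReps g
        ∎
      where
      open ≈-Reasoning
      h : Fin n → ℤ
      h i = + toℕ (roots σ i) ℤ.* ∣ Vec.lookup g (cycleOf i) ∣ᵥ
      grouped : ∑ℤ h (allFin n) ≡ degSum (λ r x → + rootSum r ℤ.* ∣ x ∣ᵥ) cycleReps g
      grouped = ≡.trans (∑-by-cycles ℤ.+-*-commutativeRing (λ s j → + toℕ (roots σ s) ℤ.* ∣ Vec.lookup g j ∣ᵥ))
                (≡.trans (ℤ∑.∑-cong (allFin #cycles) (λ {j} _ →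
                   ≡.trans (≡.sym (ℤ∑.*-distribʳ-∑ ∣ Vec.lookup g j ∣ᵥ (λ s → + toℕ (roots σ s)) (orbit σ (cycleRep j))))
                           (≡.cong (ℤ._* ∣ Vec.lookup g j ∣ᵥ) (≡.sym (pos-∑ (toℕ ∘ roots σ) (orbit σ (cycleRep j)))))))
                (≡.sym (degSum-lookup (λ r x → + rootSum r ℤ.* ∣ x ∣ᵥ) cycleReps g)))

    trace≈cycleSum : Unique Ld → ∀ e → trace σ a′ Ld e ≈ cycleSum e
    trace≈cycleSum Ld! e = begin
      trace σ a′ Ld e                                         ≈⟨ ∑-filterᵇ weight isFixed (filterᵇ ofDeg (tuples Ld n)) ⟨
      ∑ weight (filterᵇ isFixed (filterᵇ ofDeg (tuples Ld n))) ≈⟨ ∑-same-elements (Vec.≡-dec (Vec.≡-dec ℤ._≟_)) weight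
                                                                  (fixed-unique ofDeg Ld Ld!) (spread-unique ofDeg Ld Ld!)
                                                                  (fixed⇒spread ofDeg Ld) (spread⇒fixed ofDeg Ld) ⟩
      ∑ weight (map spread (filterᵇ (ofDeg ∘ spread) Tc))     ≡⟨ ∑-map weight spread (filterᵇ (ofDeg ∘ spread) Tc) ⟩
      ∑ (weight ∘ spread) (filterᵇ (ofDeg ∘ spread) Tc)       ≈⟨ ∑-filterᵇ (weight ∘ spread) (ofDeg ∘ spread) Tc ⟩
      ∑ (λ g → if ofDeg (spread g) then weight (spread g) else 0#) Tc
                                                              ≈⟨ ∑-cong Tc (λ {g} _ →
                                                                   if-cong (≡.cong (λ d → does (d ℤ.≟ e)) (combDeg-spread g))
                                                                           (weight-spread g)) ⟩
      cycleSum e                                              ∎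
      where
      open ≈-Reasoning
      Tc = tuples Ld #cycles
      ofDeg : Vec (Vec ℤ m) n → Bool
      ofDeg v = does (combDeg a′ v ℤ.≟ e)
      if-cong : ∀ {b b′ x y} → b ≡ b′ → x ≈ y → (if b then x else 0#) ≈ (if b′ then y else 0#)
      if-cong {true}  ≡.refl x≈y = x≈y
      if-cong {false} ≡.refl _   = refl

proposition5p6 :
    ∀ {c ℓ : Level} (m n k r : ℕ) .{{_ : NonZero k}} →
    1 ℕ.≤ n →
    (V : Fin r → Vec ℤ m) → FullDimensional V →
    (a′ : Vec ℤ m) →
    (R : CommutativeRing c ℓ) (ζ : CommutativeRing.Carrier R) →
    CommutativeRing._≈_ R (Coeffs.pow R k ζ ζ k) (CommutativeRing.1# R) →
    (∀ j → 0 ℕ.< j → j ℕ.< k → ¬ CommutativeRing._≈_ R (Coeffs.pow R k ζ ζ j) (CommutativeRing.1# R)) →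
    (σ : Wreath k n) →
    (d : ℕ) (Ld : List (Vec ℤ m)) → Unique Ld → (∀ v → (v ∈ Ld) ⇔ InDilate V d v) →
    (e : ℤ) →
    CommutativeRing._≈_ R
      (Coeffs.trace R k ζ σ a′ Ld e)
      (Coeffs.coeff R k ζ e (Coeffs.rhsPoly R k ζ a′ Ld (cycleType σ)))
proposition5p6 m n k r _ V _ a′ R ζ ζ^k≈1 _ σ d Ld Ld! _ e =
  trans (trace≈cycleSum ζ^k≈1 Ld! e) (sym (rhs≈cycleSum e))
  where
  open CommutativeRing R using (trans; sym)
  open TraceFormula R k ζ σ a′ Ld
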